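{- Let $n\ge 1$. (1) A permutation $\pi\in S_n$ avoids $(12,\{(0,0),(0,1),(0,2)\})$ if and only if $\pi_1=n$; hence $|S_n(12,\{(0,0),(0,1),(0,2)\})|=(n-1)!$. (2) A permutation $\pi\in S_n$ avoids $(12,\{(0,1),(1,1),(2,0),(2,2)\})$ if and only if $\pi_n=1$; hence the number of avoiders in $S_n$ is $(n-1)!$. (3) A permutation $\pi\in S_n$ avoids $(12,\{(0,0),(0,2),(1,1)\})$ if and only if $\pi_1=n$; hence the number of avoiders in $S_n$ is $(n-1)!$.
   Context: $S_n$ is the set of permutations of $\{1,\dots,n\}$, written $\pi=\pi_1\cdots\pi_n$. A mesh pattern $(12,R)$ of length 2 has $R\subseteq\{0,1,2\}^2$ (shaded boxes). A permutation $\pi\in S_n$ contains $(12,R)$ if there exist indices $i<j$ with $\pi_i<\pi_j$ such that, with $p_0=0,p_1=i,p_2=j,p_3=n+1$ and $v_0=0,v_1=\pi_i,v_2=\pi_j,v_3=n+1$, for every $(a,b)\in R$ there is no index $x$ with $p_a<x<p_{a+1}$ and $v_b<\pi_x<v_{b+1}$. Otherwise $\pi$ avoids it; $S_n(p)$ denotes the set of avoiders of $p$ in $S_n$. -}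

module Defs where

open import Data.Nat using (ℕ; zero; suc; _<_)
open import Data.Fin using (Fin; toℕ; inject₁) renaming (zero to fz; suc to fs)
open import Data.Fin.Properties using (_≟_)
open import Data.Vec using (Vec; []; _∷_; lookup)
open import Data.Bool using (Bool; true; false; _∧_; not; T)
open import Data.Product using (Σ; ∃; _×_)
open import Data.List using (List)
open import Data.List.Membership.Propositional using (_∈_)
open import Relation.Nullary using (¬_; does)

occurs : ∀ {n k} → Fin n → Vec (Fin n) k → Bool
occurs x []       = false
occurs x (y ∷ ys) = does (x ≟ y) Data.Bool.∨ occurs x ys

distinct : ∀ {n k} → Vec (Fin n) k → Bool
distinct []       = true
distinct (x ∷ xs) = not (occurs x xs) ∧ distinct xs

-- S_n : permutations of {1..n} in one-line notation, stored 0-based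
-- (entry i, value j stand for position i+1, value j+1).
-- The proof component T (...) is proof-irrelevant, so equality of
-- permutations is equality of their one-line words.
Perm : ℕ → Set
Perm n = Σ (Vec (Fin n) n) (λ w → T (distinct w))

-- π_i as a 1-based value, with i a 0-based position
val : ∀ {n} → Perm n → Fin n → ℕ
val (w Data.Product., _) i = suc (toℕ (lookup w i))

pos : ∀ {n} → Fin n → ℕ
pos i = suc (toℕ i)

bound : ℕ → ℕ → ℕ → Fin 4 → ℕ
bound n u v fz                = 0
bound n u v (fs fz)           = u
bound n u v (fs (fs fz))      = v
bound n u v (fs (fs (fs fz))) = suc n

Box : Set
Box = Fin 3 × Fin 3

OccursAt : ∀ {n} → Perm n → List Box → Fin n → Fin n → Set
OccursAt {n} π R i j =
  pos i < pos j × val π i < val π j ×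
  (∀ {a b} → (a Data.Product., b) ∈ R → ¬ (∃ λ (x : Fin n) →
      (bound n (pos i) (pos j) (inject₁ a) < pos x × pos x < bound n (pos i) (pos j) (fs a)) ×
      (bound n (val π i) (val π j) (inject₁ b) < val π x × val π x < bound n (val π i) (val π j) (fs b))))

Contains : ∀ {n} → Perm n → List Box → Set
Contains {n} π R = ∃ λ (i : Fin n) → ∃ λ (j : Fin n) → OccursAt π R i j

Avoids : ∀ {n} → Perm n → List Box → Set
Avoids π R = ¬ Contains π R

-- S_n(12,R)
-- The avoidance proof is an irrelevant field, so two elements are equal
-- iff their permutations are equal (this makes counting via ↔ meaningful).
record Avoiders (n : ℕ) (R : List Box) : Set where
  constructor avoider
  field
    perm    : Perm n
    .avoids : Avoids perm R

R₁ R₂ R₃ : List Box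
R₁ = (fz Data.Product., fz) ∷ₗ (fz Data.Product., fs fz) ∷ₗ (fz Data.Product., fs (fs fz)) ∷ₗ List.[]
  where open Data.List renaming (_∷_ to _∷ₗ_)
R₂ = (fz Data.Product., fs fz) ∷ₗ (fs fz Data.Product., fs fz) ∷ₗ (fs (fs fz) Data.Product., fz) ∷ₗ (fs (fs fz) Data.Product., fs (fs fz)) ∷ₗ List.[]
  where open Data.List renaming (_∷_ to _∷ₗ_)
R₃ = (fz Data.Product., fz) ∷ₗ (fz Data.Product., fs (fs fz)) ∷ₗ (fs fz Data.Product., fs fz) ∷ₗ List.[]
  where open Data.List renaming (_∷_ to _∷ₗ_)

-- For shadings (1) and (3), if π₁ < n then π₁ and the entry π₁ + 1 form an
-- occurrence whose shaded boxes are empty: nothing lies left of position 1 and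
-- no value lies strictly between two consecutive values. If π₁ = n, then any
-- 12 either starts at position 1, which is impossible, or has the entry n in
-- its shaded box (0,2). Shading (2) is the mirror argument with the last
-- position and the value 1. The avoiders are thus the permutations with a
-- prescribed entry at the first or last position, and these correspond to
-- S_{n-1} by deleting that entry.
module Submission where

open import Defs
open import Data.Bool using (true; false; T; not)
open import Data.Bool.Properties using (T-∧; T-∨; T-irrelevant)
open import Data.Empty using (⊥-elim)
open import Data.Fin using (Fin; zero; toℕ; fromℕ; fromℕ<; inject₁; opposite; punchIn; punchOut)
  renaming (suc to fs)
open import Data.Fin.Properties
  using (_≟_; toℕ-injective; toℕ<n; toℕ-fromℕ; toℕ-fromℕ<; 0≢1+n; suc-injective; opposite-involutive;
         punchIn-injective; punchInᵢ≢i; punchOut-injective; punchOut-cong; punchOut-punchIn;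
         punchIn-punchOut; any?; pigeonhole; *↔×)
  renaming (<⇒≢ to <⇒≢ᶠ)
open import Data.List using (List)
open import Data.List.Membership.Propositional using (_∈_)
open import Data.List.Relation.Unary.Any using (here; there)
open import Data.Nat using (ℕ; suc; _!; _≤_; _<_; z≤n; s≤s; s≤s⁻¹; z<s; s<s)
import Data.Nat.Properties as ℕ
open import Data.Product using (Σ; ∃; _×_; _,_; proj₁; proj₂)
open import Data.Product.Function.NonDependent.Propositional using (_×-↔_)
open import Data.Sum using (_⊎_; inj₁; inj₂)
open import Data.Unit using (tt)
open import Data.Vec using (Vec; []; _∷_; lookup; tabulate)
open import Data.Vec.Functional using () renaming (_∷_ to _∷ᶠ_)
open import Data.Vec.Properties using (lookup∘tabulate; tabulate∘lookup; tabulate-cong)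
open import Function using (_∘_)
open import Function.Bundles using (_⇔_; _↔_; mk⇔; mk↔ₛ′; Equivalence)
open import Function.Construct.Composition using (_⇔-∘_)
open import Function.Definitions using (Injective)
open import Function.Properties.Inverse using (↔-refl; ↔-sym; ↔-trans)
open import Relation.Binary.PropositionalEquality using (_≡_; _≢_; refl; sym; trans; cong; subst)
open import Relation.Nullary using (¬_; yes; no)
open import Relation.Nullary.Decidable using (decidable-stable; recompute)
open import Axiom.UniquenessOfIdentityProofs using (module Decidable⇒UIP)

T-not : ∀ {b} → T (not b) ⇔ (¬ T b)
T-not {true}  = mk⇔ (λ ()) (λ ¬t → ¬t tt)
T-not {false} = mk⇔ (λ _ ()) (λ _ → tt)

distinct-∷ : ∀ {n k} (x : Fin n) (xs : Vec (Fin n) k) →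
             T (distinct (x ∷ xs)) ⇔ (¬ T (occurs x xs) × T (distinct xs))
distinct-∷ _ _ = mk⇔ (λ d → let (f , r) = Equivalence.to T-∧ d in Equivalence.to T-not f , r)
                     (λ (f , r) → Equivalence.from T-∧ (Equivalence.from T-not f , r))

occurs⇒lookup : ∀ {n k} (x : Fin n) (w : Vec (Fin n) k) → T (occurs x w) → ∃ λ i → lookup w i ≡ x
occurs⇒lookup x (y ∷ ys) o with x ≟ y
... | yes x≡y = zero , sym x≡y
... | no _    = let (i , e) = occurs⇒lookup x ys o in fs i , e

lookup-occurs : ∀ {n k} (w : Vec (Fin n) k) i → T (occurs (lookup w i) w)
lookup-occurs (y ∷ ys) zero with y ≟ y
... | yes _   = tt
... | no y≢y  = ⊥-elim (y≢y refl)
lookup-occurs (y ∷ ys) (fs i) = Equivalence.from T-∨ (inj₂ (lookup-occurs ys i))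

distinct⇒injective : ∀ {n k} (w : Vec (Fin n) k) → T (distinct w) → Injective _≡_ _≡_ (lookup w)
distinct⇒injective (x ∷ xs) d {zero} {zero} _ = refl
distinct⇒injective (x ∷ xs) d {zero} {fs j} e =
  ⊥-elim (proj₁ (Equivalence.to (distinct-∷ x xs) d) (subst (λ y → T (occurs y xs)) (sym e) (lookup-occurs xs j)))
distinct⇒injective (x ∷ xs) d {fs i} {zero} e =
  ⊥-elim (proj₁ (Equivalence.to (distinct-∷ x xs) d) (subst (λ y → T (occurs y xs)) e (lookup-occurs xs i)))
distinct⇒injective (x ∷ xs) d {fs i} {fs j} e =
  cong fs (distinct⇒injective xs (proj₂ (Equivalence.to (distinct-∷ x xs) d)) e)

injective⇒distinct : ∀ {n k} (w : Vec (Fin n) k) → Injective _≡_ _≡_ (lookup w) → T (distinct w)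
injective⇒distinct []       _   = tt
injective⇒distinct (x ∷ xs) inj =
  Equivalence.from (distinct-∷ x xs) (fresh , injective⇒distinct xs (suc-injective ∘ inj))
  where
  fresh : ¬ T (occurs x xs)
  fresh o = let (i , e) = occurs⇒lookup x xs o in 0≢1+n (inj {zero} {fs i} (sym e))

perm-injective : ∀ {n} (π : Perm n) → Injective _≡_ _≡_ (lookup (proj₁ π))
perm-injective (w , d) = distinct⇒injective w d

perm : ∀ {n} (f : Fin n → Fin n) → Injective _≡_ _≡_ f → Perm n
perm f inj = tabulate f , injective⇒distinct (tabulate f)
  (λ {i} {j} e → inj (trans (sym (lookup∘tabulate f i)) (trans e (lookup∘tabulate f j))))

Perm-≡ : ∀ {n} {π ρ : Perm n} → (∀ i → lookup (proj₁ π) i ≡ lookup (proj₁ ρ) i) → π ≡ ρ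
Perm-≡ {π = w , d} {v , e} eq with trans (sym (tabulate∘lookup w)) (trans (tabulate-cong eq) (tabulate∘lookup v))
... | refl = cong (w ,_) (T-irrelevant d e)

-- An injective endomap of Fin (suc m) missing y would inject into Fin m via punchOut y.
injective⇒surjective : ∀ {n} (f : Fin n → Fin n) → Injective _≡_ _≡_ f → ∀ y → ∃ λ x → f x ≡ y
injective⇒surjective {suc m} f inj y = decidable-stable (any? λ x → f x ≟ y) hit
  where
  hit : ¬ ¬ ∃ λ x → f x ≡ y
  hit miss =
    let (i , j , i<j , e) = pigeonhole (ℕ.n<1+n m) (λ x → punchOut (missed x))
    in <⇒≢ᶠ i<j (inj (punchOut-injective (missed i) (missed j) e))
    where
    missed : ∀ x → y ≢ f x
    missed x e = miss (x , sym e)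

pos-injective : ∀ {n} {x y : Fin n} → pos x ≡ pos y → x ≡ y
pos-injective = toℕ-injective ∘ ℕ.suc-injective

pos≤ : ∀ {n} (x : Fin n) → pos x ≤ n
pos≤ = toℕ<n

val-injective : ∀ {n} (π : Perm n) {x y} → val π x ≡ val π y → x ≡ y
val-injective π = perm-injective π ∘ toℕ-injective ∘ ℕ.suc-injective

val≤ : ∀ {n} (π : Perm n) x → val π x ≤ n
val≤ (w , _) x = toℕ<n (lookup w x)

val-surjective : ∀ {n} (π : Perm n) {k} → k < n → ∃ λ x → val π x ≡ suc k
val-surjective π k<n =
  let (x , e) = injective⇒surjective _ (perm-injective π) (fromℕ< k<n)
  in x , cong suc (trans (cong toℕ e) (toℕ-fromℕ< k<n))

successor : ∀ {n} (π : Perm n) x → val π x ≢ n → ∃ λ y → val π y ≡ suc (val π x)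
successor π x ≢n = val-surjective π (ℕ.≤∧≢⇒< (val≤ π x) ≢n)

predecessor : ∀ {n} (π : Perm n) x → val π x ≢ 1 → ∃ λ y → val π x ≡ suc (val π y)
predecessor (w , d) x ≢1 with toℕ (lookup w x) | toℕ<n (lookup w x)
... | 0     | _   = ⊥-elim (≢1 refl)
... | suc k | k<n = let (y , e) = val-surjective (w , d) (ℕ.<-trans (ℕ.n<1+n k) k<n) in y , cong suc (sym e)

val≡⇔lookup≡fromℕ : ∀ {m} (π : Perm (suc m)) x → val π x ≡ suc m ⇔ lookup (proj₁ π) x ≡ fromℕ m
val≡⇔lookup≡fromℕ {m} π x =
  mk⇔ (λ e → toℕ-injective (trans (ℕ.suc-injective e) (sym (toℕ-fromℕ m))))
      (λ e → cong suc (trans (cong toℕ e) (toℕ-fromℕ m)))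

val≡⇔lookup≡zero : ∀ {m} (π : Perm (suc m)) x → val π x ≡ 1 ⇔ lookup (proj₁ π) x ≡ zero
val≡⇔lookup≡zero π x = mk⇔ (toℕ-injective ∘ ℕ.suc-injective) (cong (suc ∘ toℕ))

InBox : ∀ {n} → Perm n → Fin n → Fin n → Box → Fin n → Set
InBox {n} π i j (a , b) x =
  (bound n (pos i) (pos j) (inject₁ a) < pos x × pos x < bound n (pos i) (pos j) (fs a)) ×
  (bound n (val π i) (val π j) (inject₁ b) < val π x × val π x < bound n (val π i) (val π j) (fs b))

column₀-empty-at-first : ∀ {n} (π : Perm (suc n)) j b x → ¬ InBox π zero j (zero , b) x
column₀-empty-at-first π j b x ((_ , s≤s ()) , _)

column₂-empty-at-last : ∀ {n} (π : Perm n) i j b x → pos j ≡ n → ¬ InBox π i j (fs (fs zero) , b) x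
column₂-empty-at-last π i j b x j-last ((j<x , _) , _) = ℕ.<⇒≱ j<x (subst (pos x ≤_) (sym j-last) (pos≤ x))

row₁-empty-if-adjacent : ∀ {n} (π : Perm n) i j a x → val π j ≡ suc (val π i) → ¬ InBox π i j (a , fs zero) x
row₁-empty-if-adjacent π i j a x adj (_ , (i<x , x<j)) = ℕ.<⇒≱ i<x (s≤s⁻¹ (subst (val π x <_) adj x<j))

InColumn₀OrCentre : List Box → Set
InColumn₀OrCentre R = ∀ {a b} → (a , b) ∈ R → a ≡ zero ⊎ (a , b) ≡ (fs zero , fs zero)

InRow₁OrColumn₂ : List Box → Set
InRow₁OrColumn₂ R = ∀ {a b} → (a , b) ∈ R → b ≡ fs zero ⊎ a ≡ fs (fs zero)

avoids-if-first-max : ∀ {m R} → (zero , fs (fs zero)) ∈ R → (π : Perm (suc m)) → val π zero ≡ suc m → Avoids π R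
avoids-if-first-max mem π top (zero , j , _ , first<j , _) =
  ℕ.<⇒≱ first<j (subst (val π j ≤_) (sym top) (val≤ π j))
avoids-if-first-max mem π top (fs i , zero , s≤s () , _)
avoids-if-first-max mem π top (fs i , fs j , _ , _ , empty) =
  empty mem (zero , (z<s , s<s z<s) , (j<first , s≤s (val≤ π zero)))
  where
  j<first = ℕ.≤∧≢⇒< (subst (val π (fs j) ≤_) (sym top) (val≤ π (fs j))) (λ e → 0≢1+n (val-injective π (sym e)))

contains-if-first-not-max : ∀ {m R} → InColumn₀OrCentre R → (π : Perm (suc m)) → val π zero ≢ suc m → Contains π R
contains-if-first-not-max shape π not-top with successor π zero not-top
... | zero , e = ⊥-elim (ℕ.1+n≢n (sym e))
... | fs j , adj = zero , fs j , s<s z<s , subst (val π zero <_) (sym adj) ℕ.≤-refl , empty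
  where
  empty : ∀ {a b} → (a , b) ∈ _ → ¬ ∃ (InBox π zero (fs j) (a , b))
  empty {a} {b} mem (x , inBox) with shape mem
  ... | inj₁ refl = column₀-empty-at-first π (fs j) b x inBox
  ... | inj₂ refl = row₁-empty-if-adjacent π zero (fs j) (fs zero) x adj inBox

avoids-if-last-min : ∀ {n R} → (fs (fs zero) , zero) ∈ R → (π : Perm n) (ℓ : Fin n) →
                     pos ℓ ≡ n → val π ℓ ≡ 1 → Avoids π R
avoids-if-last-min mem π ℓ last bottom (i , j , i<j , i<ᵥj , empty) with j ≟ ℓ
... | yes refl = ℕ.<⇒≱ i<ᵥj (subst (_≤ val π i) (sym bottom) (s≤s z≤n))
... | no j≢ℓ   = empty mem (ℓ , (j<ℓ , s≤s (pos≤ ℓ)) , (z<s , ℓ<ᵥi))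
  where
  pos≤ℓ : ∀ x → pos x ≤ pos ℓ
  pos≤ℓ x = subst (pos x ≤_) (sym last) (pos≤ x)
  j<ℓ = ℕ.≤∧≢⇒< (pos≤ℓ j) (j≢ℓ ∘ pos-injective)
  i≢ℓ : i ≢ ℓ
  i≢ℓ refl = ℕ.<⇒≱ i<j (pos≤ℓ j)
  ℓ<ᵥi = ℕ.≤∧≢⇒< (subst (_≤ val π i) (sym bottom) (s≤s z≤n)) (λ e → i≢ℓ (val-injective π (sym e)))

contains-if-last-not-min : ∀ {n R} → InRow₁OrColumn₂ R → (π : Perm n) (ℓ : Fin n) →
                           pos ℓ ≡ n → val π ℓ ≢ 1 → Contains π R
contains-if-last-not-min shape π ℓ last not-bottom = i , ℓ , i<ℓ , subst (val π i <_) (sym adj) ℕ.≤-refl , empty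
  where
  i   = proj₁ (predecessor π ℓ not-bottom)
  adj = proj₂ (predecessor π ℓ not-bottom)
  i≢ℓ : i ≢ ℓ
  i≢ℓ e = ℕ.1+n≢n (sym (trans adj (cong (suc ∘ val π) e)))
  i<ℓ = ℕ.≤∧≢⇒< (subst (pos i ≤_) (sym last) (pos≤ i)) (i≢ℓ ∘ pos-injective)
  empty : ∀ {a b} → (a , b) ∈ _ → ¬ ∃ (InBox π i ℓ (a , b))
  empty {a} {b} mem (x , inBox) with shape mem
  ... | inj₁ refl = row₁-empty-if-adjacent π i ℓ a x adj inBox
  ... | inj₂ refl = column₂-empty-at-last π i ℓ b x last inBox

avoids⇔first-max : ∀ {m R} → InColumn₀OrCentre R → (zero , fs (fs zero)) ∈ R →
                   (π : Perm (suc m)) → Avoids π R ⇔ (lookup (proj₁ π) zero ≡ fromℕ m)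
avoids⇔first-max {m} shape mem π = val≡⇔lookup≡fromℕ π zero ⇔-∘
  mk⇔ (λ av → decidable-stable (val π zero ℕ.≟ suc m) (av ∘ contains-if-first-not-max shape π))
      (avoids-if-first-max mem π)

avoids⇔last-min : ∀ {m R} → InRow₁OrColumn₂ R → (fs (fs zero) , zero) ∈ R →
                  (π : Perm (suc m)) → Avoids π R ⇔ (lookup (proj₁ π) (fromℕ m) ≡ zero)
avoids⇔last-min {m} shape mem π = val≡⇔lookup≡zero π (fromℕ m) ⇔-∘
  mk⇔ (λ av → decidable-stable (val π (fromℕ m) ℕ.≟ 1) (av ∘ contains-if-last-not-min shape π (fromℕ m) last))
      (avoids-if-last-min mem π (fromℕ m) last)
  where
  last = cong suc (toℕ-fromℕ m)

fiber-≡ : ∀ {A : Set} {k} {f : A → Fin k} {a} {x y : Σ A (λ z → f z ≡ a)} → proj₁ x ≡ proj₁ y → x ≡ y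
fiber-≡ {x = z , p} {.z , q} refl = cong (z ,_) (≡-irrelevant p q)
  where open Decidable⇒UIP _≟_

Avoiders↔fiber : ∀ {n k R} (f : Perm n → Fin k) (a : Fin k) → (∀ π → Avoids π R ⇔ (f π ≡ a)) →
                 Avoiders n R ↔ Σ (Perm n) (λ π → f π ≡ a)
Avoiders↔fiber {n} {R = R} f a iff = mk↔ₛ′ to from (λ _ → fiber-≡ refl) (λ _ → refl)
  where
  to : Avoiders n R → Σ (Perm n) (λ π → f π ≡ a)
  to (avoider π av) = π , recompute (f π ≟ a) (Equivalence.to (iff π) av)
  from : Σ (Perm n) (λ π → f π ≡ a) → Avoiders n R
  from (π , e) = avoider π (Equivalence.from (iff π) e)

head : ∀ {m} → Perm (suc m) → Fin (suc m)
head π = lookup (proj₁ π) zero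

cons : ∀ {m} → Fin (suc m) → Perm m → Perm (suc m)
cons a ρ = perm (a ∷ᶠ punchIn a ∘ lookup (proj₁ ρ)) inj
  where
  inj : Injective _≡_ _≡_ (a ∷ᶠ punchIn a ∘ lookup (proj₁ ρ))
  inj {zero} {zero}  _ = refl
  inj {zero} {fs j}  e = ⊥-elim (punchInᵢ≢i a _ (sym e))
  inj {fs i} {zero}  e = ⊥-elim (punchInᵢ≢i a _ e)
  inj {fs i} {fs j}  e = cong fs (perm-injective ρ (punchIn-injective a _ _ e))

lookup-cons : ∀ {m} (a : Fin (suc m)) (ρ : Perm m) i →
              lookup (proj₁ (cons a ρ)) i ≡ (a ∷ᶠ punchIn a ∘ lookup (proj₁ ρ)) i
lookup-cons a ρ = lookup∘tabulate (a ∷ᶠ punchIn a ∘ lookup (proj₁ ρ))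

head≢ : ∀ {m} (π : Perm (suc m)) i → head π ≢ lookup (proj₁ π) (fs i)
head≢ π i = 0≢1+n ∘ perm-injective π

tail : ∀ {m} → Perm (suc m) → Perm m
tail π = perm (λ i → punchOut (head≢ π i))
              (λ e → suc-injective (perm-injective π (punchOut-injective (head≢ π _) (head≢ π _) e)))

lookup-tail : ∀ {m} (π : Perm (suc m)) i → lookup (proj₁ (tail π)) i ≡ punchOut (head≢ π i)
lookup-tail π = lookup∘tabulate (λ i → punchOut (head≢ π i))

tail-cons : ∀ {m} (a : Fin (suc m)) (ρ : Perm m) → tail (cons a ρ) ≡ ρ
tail-cons a ρ = Perm-≡ λ i →
  trans (lookup-tail (cons a ρ) i) (trans (punchOut-cong a (lookup-cons a ρ (fs i))) (punchOut-punchIn a))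

cons-tail : ∀ {m} (π : Perm (suc m)) → cons (head π) (tail π) ≡ π
cons-tail π = Perm-≡ λ
  { zero   → lookup-cons (head π) (tail π) zero
  ; (fs i) → trans (lookup-cons (head π) (tail π) (fs i))
                   (trans (cong (punchIn (head π)) (lookup-tail π i)) (punchIn-punchOut (head≢ π i)))
  }

Perm-suc↔ : ∀ {m} → Perm (suc m) ↔ (Fin (suc m) × Perm m)
Perm-suc↔ = mk↔ₛ′ (λ π → head π , tail π) (λ (a , ρ) → cons a ρ)
                  (λ (a , ρ) → cong (a ,_) (tail-cons a ρ)) cons-tail

Perm↔Fin! : ∀ n → Perm n ↔ Fin (n !)
Perm↔Fin! 0       = mk↔ₛ′ (λ _ → zero) (λ _ → [] , tt) (λ { zero → refl ; (fs ()) }) (λ { ([] , tt) → refl })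
Perm↔Fin! (suc m) = ↔-trans Perm-suc↔ (↔-trans (↔-refl ×-↔ Perm↔Fin! m) (↔-sym *↔×))

head-fiber↔ : ∀ {m} (a : Fin (suc m)) → Σ (Perm (suc m)) (λ π → head π ≡ a) ↔ Perm m
head-fiber↔ a = mk↔ₛ′ (tail ∘ proj₁) (λ ρ → cons a ρ , refl) (tail-cons a)
  λ (π , e) → fiber-≡ (trans (cong (λ b → cons b (tail π)) (sym e)) (cons-tail π))

reverse : ∀ {n} → Perm n → Perm n
reverse π = perm (lookup (proj₁ π) ∘ opposite)
  (λ {i} {j} e → trans (sym (opposite-involutive i)) (trans (cong opposite (perm-injective π e)) (opposite-involutive j)))

lookup-reverse : ∀ {n} (π : Perm n) i → lookup (proj₁ (reverse π)) i ≡ lookup (proj₁ π) (opposite i)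
lookup-reverse π = lookup∘tabulate (lookup (proj₁ π) ∘ opposite)

reverse-involutive : ∀ {n} (π : Perm n) → reverse (reverse π) ≡ π
reverse-involutive π = Perm-≡ λ i →
  trans (lookup-reverse (reverse π) i)
        (trans (lookup-reverse π (opposite i)) (cong (lookup (proj₁ π)) (opposite-involutive i)))

last-fiber↔ : ∀ {m} (a : Fin (suc m)) → Σ (Perm (suc m)) (λ π → lookup (proj₁ π) (fromℕ m) ≡ a) ↔ Perm m
last-fiber↔ {m} a = ↔-trans reversed (head-fiber↔ a)
  where
  reversed : Σ (Perm (suc m)) (λ π → lookup (proj₁ π) (fromℕ m) ≡ a) ↔ Σ (Perm (suc m)) (λ π → head π ≡ a)
  reversed = mk↔ₛ′ (λ (π , e) → reverse π , trans (lookup-reverse π zero) e)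
                   (λ (ρ , e) → reverse ρ , trans (lookup-reverse ρ (fromℕ m))
                                                  (trans (cong (lookup (proj₁ ρ)) (opposite-involutive zero)) e))
                   (λ (ρ , _) → fiber-≡ (reverse-involutive ρ))
                   (λ (π , _) → fiber-≡ (reverse-involutive π))

count-avoiders : ∀ {m R} (f : Perm (suc m) → Fin (suc m)) (a : Fin (suc m)) →
                 (∀ π → Avoids π R ⇔ (f π ≡ a)) → Σ (Perm (suc m)) (λ π → f π ≡ a) ↔ Perm m →
                 Avoiders (suc m) R ↔ Fin (m !)
count-avoiders {m} f a iff fiber = ↔-trans (Avoiders↔fiber f a iff) (↔-trans fiber (Perm↔Fin! m))

R₁-shape : InColumn₀OrCentre R₁
R₁-shape (here refl)                 = inj₁ refl
R₁-shape (there (here refl))         = inj₁ refl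
R₁-shape (there (there (here refl))) = inj₁ refl

R₂-shape : InRow₁OrColumn₂ R₂
R₂-shape (here refl)                         = inj₁ refl
R₂-shape (there (here refl))                 = inj₁ refl
R₂-shape (there (there (here refl)))         = inj₂ refl
R₂-shape (there (there (there (here refl)))) = inj₂ refl

R₃-shape : InColumn₀OrCentre R₃
R₃-shape (here refl)                 = inj₁ refl
R₃-shape (there (here refl))         = inj₁ refl
R₃-shape (there (there (here refl))) = inj₂ refl

proposition4p3 : (m : ℕ) →
    (((π : Perm (suc m)) → Avoids π R₁ ⇔ (lookup (proj₁ π) zero ≡ fromℕ m)) × (Avoiders (suc m) R₁ ↔ Fin (m !)))
    × (((π : Perm (suc m)) → Avoids π R₂ ⇔ (lookup (proj₁ π) (fromℕ m) ≡ zero)) × (Avoiders (suc m) R₂ ↔ Fin (m !)))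
    × (((π : Perm (suc m)) → Avoids π R₃ ⇔ (lookup (proj₁ π) zero ≡ fromℕ m)) × (Avoiders (suc m) R₃ ↔ Fin (m !)))
proposition4p3 m =
  (iff₁ , count-avoiders head (fromℕ m) iff₁ (head-fiber↔ (fromℕ m))) ,
  (iff₂ , count-avoiders (λ π → lookup (proj₁ π) (fromℕ m)) zero iff₂ (last-fiber↔ zero)) ,
  (iff₃ , count-avoiders head (fromℕ m) iff₃ (head-fiber↔ (fromℕ m)))
  where
  iff₁ = avoids⇔first-max R₁-shape (there (there (here refl)))
  iff₂ = avoids⇔last-min R₂-shape (there (there (here refl)))
  iff₃ = avoids⇔first-max R₃-shape (there (here refl))
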